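{- Honda and Tokoro's encoding $\mathcal T_{\rm HT}$ is not valid up to asynchronous weak barbed bisimilarity $\approx_{\mathrm{AWBB}}$, and hence not up to weak barbed bisimilarity $\approx_{\mathrm{WBB}}$, weak $o\tau$-bisimilarity, or weak asynchronous bisimilarity: e.g. for $P=\bar xz.\mathbf 0$ one has $\mathcal T_{\rm HT}(P)\not\approx_{\mathrm{AWBB}}P$.
   Context: Fix an infinite set $\mathcal N$ of names. Processes of $\pi$: $P ::= \mathbf{0} \mid \bar x z.P \mid x(y).P \mid P|Q \mid (y)P \mid\ !P$; $\mathrm{fn}(P)$, $\mathrm n(P)$ free/all names; $P\{w/y\}$ capture-avoiding substitution. Structural congruence $\equiv$: smallest congruence with $P|(Q|R)\equiv(P|Q)|R$, $P|Q\equiv Q|P$, $P|\mathbf 0\equiv P$, $!P\equiv P|!P$, $(y)\mathbf 0\equiv\mathbf 0$, $(y)(u)P\equiv(u)(y)P$, $(w)(P|Q)\equiv P|(w)Q$, $(y)P\equiv(w)P\{w/y\}$, $x(y).P\equiv x(w).P\{w/y\}$ ($w\notin\mathrm n(P)$). Reduction $\longmapsto$: generated by $\bar xz.P|x(y).Q\longmapsto P|Q\{z/y\}$, closed under $-|Q$, restriction and $\equiv$; $\longmapsto^*$ reflexive-transitive closure. $\mathcal T_{\rm HT}$: homomorphic on $\mathbf 0,|,!$, restriction; $\mathcal T_{\rm HT}(\bar xz.P)=x(u).(\bar uz|\mathcal T_{\rm HT}(P))$, $u\notin\mathrm{fn}(P)\cup\{x,z\}$; $\mathcal T_{\rm HT}(x(y).P)=(u)(\bar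 xu|u(y).\mathcal T_{\rm HT}(P))$, $u\notin\mathrm{fn}(P)\cup\{x\}$. Barbs: $P\downarrow_x$ (resp. $P\downarrow_{\bar x}$) if $P$ has an occurrence of $x(z).R$ (resp. $\bar xy.R$) not strictly within an input/output prefix and not in the scope of a restriction binding $x$; $P\Downarrow_a$ if $P\longmapsto^*P'\downarrow_a$. A symmetric relation $S$ is an asynchronous weak barbed bisimulation if $P\,S\,Q$ implies (1) $P\downarrow_{\bar x}\Rightarrow Q\Downarrow_{\bar x}$ and (2) if $P\longmapsto P'$ then $Q\longmapsto^*Q'$ with $P'\,S\,Q'$; $\approx_{\mathrm{AWBB}}$ is the largest one. A weak barbed bisimulation requires (1) for all barbs $a\in\{x,\bar x\}$ instead of only output barbs; $\approx_{\mathrm{WBB}}$ is the largest. Weak $o\tau$-bisimilarity and weak asynchronous bisimilarity are standard labelled-transition equivalences of Amadio et al. (for the early-style labelled transition semantics of the $\pi$-calculus), both contained in $\approx_{\mathrm{AWBB}}$. -}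

module Defs where

open import Data.Nat using (ℕ; zero; suc)
open import Data.Product using (Σ; _×_; _,_; ∃)
open import Relation.Binary.Construct.Closure.ReflexiveTransitive using (Star)

-- Names are ℕ (an infinite set); binders use de Bruijn indices, so
-- α-conversion is built in. In  inp x P  (x(y).P) and  ν P  ((y)P)
-- index 0 of P is the bound name y; index (suc n) of P is the outer n.

Name : Set
Name = ℕ

data Proc : Set where
  𝟘   : Proc
  out : Name → Name → Proc → Proc
  inp : Name → Proc → Proc
  _∣_ : Proc → Proc → Proc
  ν   : Proc → Proc
  !_  : Proc → Proc

infixl 5 _∣_

ext : (Name → Name) → Name → Name
ext ρ zero    = zero
ext ρ (suc n) = suc (ρ n)

rename : (Name → Name) → Proc → Proc
rename ρ 𝟘         = 𝟘
rename ρ (out x z P) = out (ρ x) (ρ z) (rename ρ P)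
rename ρ (inp x P) = inp (ρ x) (rename (ext ρ) P)
rename ρ (P ∣ Q)   = rename ρ P ∣ rename ρ Q
rename ρ (ν P)     = ν (rename (ext ρ) P)
rename ρ (! P)     = ! rename ρ P

shift : Proc → Proc
shift = rename suc

swap01 : Name → Name
swap01 zero          = suc zero
swap01 (suc zero)    = zero
swap01 (suc (suc n)) = suc (suc n)

-- Q{z/y} where y is the innermost bound name (index 0) of Q
subst0 : Name → Name → Name
subst0 z zero    = z
subst0 z (suc n) = n

_[_/0] : Proc → Name → Proc
Q [ z /0] = rename (subst0 z) Q

-- Structural congruence: smallest congruence with the given axioms.
-- (The α-conversion axioms are identities in de Bruijn syntax; the
-- side condition w ∉ fn(P) of scope extrusion is expressed by shift.)

infix 4 _≡s_
data _≡s_ : Proc → Proc → Set where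
  refl  : ∀ {P} → P ≡s P
  sym   : ∀ {P Q} → P ≡s Q → Q ≡s P
  trans : ∀ {P Q R} → P ≡s Q → Q ≡s R → P ≡s R
  c-out : ∀ {x z P Q} → P ≡s Q → out x z P ≡s out x z Q
  c-inp : ∀ {x P Q} → P ≡s Q → inp x P ≡s inp x Q
  c-par : ∀ {P P' Q Q'} → P ≡s P' → Q ≡s Q' → P ∣ Q ≡s P' ∣ Q'
  c-res : ∀ {P Q} → P ≡s Q → ν P ≡s ν Q
  c-rep : ∀ {P Q} → P ≡s Q → ! P ≡s ! Q
  par-assoc : ∀ {P Q R} → P ∣ (Q ∣ R) ≡s (P ∣ Q) ∣ R
  par-comm  : ∀ {P Q} → P ∣ Q ≡s Q ∣ P
  par-unit  : ∀ {P} → P ∣ 𝟘 ≡s P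
  rep-unf   : ∀ {P} → ! P ≡s P ∣ ! P
  res-nil   : ν 𝟘 ≡s 𝟘
  res-swap  : ∀ {P} → ν (ν P) ≡s ν (ν (rename swap01 P))
  res-extr  : ∀ {P Q} → ν (shift P ∣ Q) ≡s P ∣ ν Q

infix 4 _⟶_
data _⟶_ : Proc → Proc → Set where
  comm   : ∀ {x z P Q} → out x z P ∣ inp x Q ⟶ P ∣ Q [ z /0]
  par    : ∀ {P P' Q} → P ⟶ P' → P ∣ Q ⟶ P' ∣ Q
  res    : ∀ {P P'} → P ⟶ P' → ν P ⟶ ν P'
  struct : ∀ {P P' Q Q'} → P ≡s P' → P' ⟶ Q' → Q' ≡s Q → P ⟶ Q

infix 4 _⟶*_
_⟶*_ : Proc → Proc → Set
_⟶*_ = Star _⟶_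

data Barb : Set where
  inB  : Name → Barb
  outB : Name → Barb

↑B : Barb → Barb
↑B (inB x)  = inB (suc x)
↑B (outB x) = outB (suc x)

infix 4 _↓_
data _↓_ : Proc → Barb → Set where
  ↓inp  : ∀ {x P} → inp x P ↓ inB x
  ↓out  : ∀ {x z P} → out x z P ↓ outB x
  ↓parˡ : ∀ {P Q a} → P ↓ a → P ∣ Q ↓ a
  ↓parʳ : ∀ {P Q a} → Q ↓ a → P ∣ Q ↓ a
  ↓res  : ∀ {P a} → P ↓ ↑B a → ν P ↓ a
  ↓rep  : ∀ {P a} → P ↓ a → ! P ↓ a

infix 4 _⇓_
_⇓_ : Proc → Barb → Set
P ⇓ a = ∃ λ P' → P ⟶* P' × P' ↓ a

Rel₀ : Set₁
Rel₀ = Proc → Proc → Set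

IsSymmetric : Rel₀ → Set
IsSymmetric S = ∀ {P Q} → S P Q → S Q P

ReductionClosed : Rel₀ → Set
ReductionClosed S = ∀ {P Q P'} → S P Q → P ⟶ P' → ∃ λ Q' → Q ⟶* Q' × S P' Q'

IsAWBB : Rel₀ → Set
IsAWBB S = IsSymmetric S
         × (∀ {P Q x} → S P Q → P ↓ outB x → Q ⇓ outB x)
         × ReductionClosed S

IsWBB : Rel₀ → Set
IsWBB S = IsSymmetric S
        × (∀ {P Q a} → S P Q → P ↓ a → Q ⇓ a)
        × ReductionClosed S

-- largest asynchronous weak barbed bisimulation (union of all of them)
infix 4 _≈AWBB_ _≈WBB_
_≈AWBB_ : Proc → Proc → Set₁
P ≈AWBB Q = Σ Rel₀ λ S → IsAWBB S × S P Q

_≈WBB_ : Proc → Proc → Set₁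
P ≈WBB Q = Σ Rel₀ λ S → IsWBB S × S P Q

-- Honda–Tokoro encoding
--   T(x̄z.P)  = x(u).(ūz | T(P))              u fresh (bound index 0)
--   T(x(y).P) = (u)(x̄u | u(y).T(P))          u fresh

T-HT : Proc → Proc
T-HT 𝟘           = 𝟘
T-HT (out x z P) = inp x (out zero (suc z) 𝟘 ∣ shift (T-HT P))
T-HT (inp x P)   = ν (out (suc x) zero 𝟘 ∣ inp zero (rename (ext suc) (T-HT P)))
T-HT (P ∣ Q)     = T-HT P ∣ T-HT Q
T-HT (ν P)       = ν (T-HT P)
T-HT (! P)       = ! T-HT P

{-# OPTIONS --safe #-}
-- The encoding turns the output x̄z.P into the input x(u).(ūz | T(P)), which
-- has no unguarded output prefix. That property is invariant under structural
-- congruence, and since every communication consumes an unguarded output, such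
-- a process cannot reduce at all; so it never shows the output barb x̄ that
-- x̄z.P exhibits at once, and the asynchronous barb clause already fails.
module Submission where

open import Defs
open import Data.Nat using (suc)
open import Data.Product using (_×_; _,_; proj₁)
open import Data.Product.Algebra using (×-assoc; ×-comm)
open import Data.Product.Function.NonDependent.Propositional using (_×-⇔_)
open import Data.Unit using (⊤; tt)
open import Data.Empty using (⊥)
open import Function.Bundles using (_⇔_; mk⇔; Equivalence)
open import Function.Properties.Inverse using (↔⇒⇔)
import Function.Properties.Equivalence as ⇔
open import Relation.Nullary using (¬_)
open import Relation.Binary.Construct.Closure.ReflexiveTransitive using (ε; _◅_)

NoUnguardedOutput : Proc → Set
NoUnguardedOutput 𝟘           = ⊤
NoUnguardedOutput (out _ _ _) = ⊥
NoUnguardedOutput (inp _ _)   = ⊤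
NoUnguardedOutput (P ∣ Q)     = NoUnguardedOutput P × NoUnguardedOutput Q
NoUnguardedOutput (ν P)       = NoUnguardedOutput P
NoUnguardedOutput (! P)       = NoUnguardedOutput P

noUnguardedOutput-rename : ∀ ρ P → NoUnguardedOutput (rename ρ P) ⇔ NoUnguardedOutput P
noUnguardedOutput-rename ρ 𝟘           = ⇔.refl
noUnguardedOutput-rename ρ (out x z P) = ⇔.refl
noUnguardedOutput-rename ρ (inp x P)   = ⇔.refl
noUnguardedOutput-rename ρ (P ∣ Q)     = noUnguardedOutput-rename ρ P ×-⇔ noUnguardedOutput-rename ρ Q
noUnguardedOutput-rename ρ (ν P)       = noUnguardedOutput-rename (ext ρ) P
noUnguardedOutput-rename ρ (! P)       = noUnguardedOutput-rename ρ P

noUnguardedOutput-resp-≡s : ∀ {P Q} → P ≡s Q → NoUnguardedOutput P ⇔ NoUnguardedOutput Q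
noUnguardedOutput-resp-≡s refl           = ⇔.refl
noUnguardedOutput-resp-≡s (sym e)        = ⇔.sym (noUnguardedOutput-resp-≡s e)
noUnguardedOutput-resp-≡s (trans e f)    = ⇔.trans (noUnguardedOutput-resp-≡s e) (noUnguardedOutput-resp-≡s f)
noUnguardedOutput-resp-≡s (c-out e)      = ⇔.refl
noUnguardedOutput-resp-≡s (c-inp e)      = ⇔.refl
noUnguardedOutput-resp-≡s (c-par e f)    = noUnguardedOutput-resp-≡s e ×-⇔ noUnguardedOutput-resp-≡s f
noUnguardedOutput-resp-≡s (c-res e)      = noUnguardedOutput-resp-≡s e
noUnguardedOutput-resp-≡s (c-rep e)      = noUnguardedOutput-resp-≡s e
noUnguardedOutput-resp-≡s par-assoc      = ⇔.sym (↔⇒⇔ (×-assoc _ _ _ _))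
noUnguardedOutput-resp-≡s par-comm       = ↔⇒⇔ (×-comm _ _)
noUnguardedOutput-resp-≡s par-unit       = mk⇔ proj₁ (_, tt)
noUnguardedOutput-resp-≡s rep-unf        = mk⇔ (λ h → h , h) proj₁
noUnguardedOutput-resp-≡s res-nil        = ⇔.refl
noUnguardedOutput-resp-≡s (res-swap {P}) = ⇔.sym (noUnguardedOutput-rename swap01 P)
noUnguardedOutput-resp-≡s (res-extr {P}) = noUnguardedOutput-rename suc P ×-⇔ ⇔.refl

noUnguardedOutput⇒irreducible : ∀ {P Q} → NoUnguardedOutput P → ¬ (P ⟶ Q)
noUnguardedOutput⇒irreducible (() , _) comm
noUnguardedOutput⇒irreducible (h , _) (par r) = noUnguardedOutput⇒irreducible h r
noUnguardedOutput⇒irreducible h (res r) = noUnguardedOutput⇒irreducible h r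
noUnguardedOutput⇒irreducible h (struct e r _) =
  noUnguardedOutput⇒irreducible (Equivalence.to (noUnguardedOutput-resp-≡s e) h) r

noUnguardedOutput⇒¬↓out : ∀ {P x} → NoUnguardedOutput P → ¬ (P ↓ outB x)
noUnguardedOutput⇒¬↓out () ↓out
noUnguardedOutput⇒¬↓out (h , _) (↓parˡ b) = noUnguardedOutput⇒¬↓out h b
noUnguardedOutput⇒¬↓out (_ , h) (↓parʳ b) = noUnguardedOutput⇒¬↓out h b
noUnguardedOutput⇒¬↓out h (↓res b) = noUnguardedOutput⇒¬↓out h b
noUnguardedOutput⇒¬↓out h (↓rep b) = noUnguardedOutput⇒¬↓out h b

noUnguardedOutput⇒¬⇓out : ∀ {P x} → NoUnguardedOutput P → ¬ (P ⇓ outB x)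
noUnguardedOutput⇒¬⇓out h (_ , ε , b)     = noUnguardedOutput⇒¬↓out h b
noUnguardedOutput⇒¬⇓out h (_ , r ◅ _ , _) = noUnguardedOutput⇒irreducible h r

noUnguardedOutput⇒≉AWBB : ∀ {P Q x} → NoUnguardedOutput P → Q ↓ outB x → ¬ (P ≈AWBB Q)
noUnguardedOutput⇒≉AWBB P-silent Q↓x̄ (S , (S-sym , S-outBarbs , _) , PSQ) =
  noUnguardedOutput⇒¬⇓out P-silent (S-outBarbs (S-sym PSQ) Q↓x̄)

T-HT-out≉AWBB : ∀ x z P → ¬ (T-HT (out x z P) ≈AWBB out x z P)
T-HT-out≉AWBB x z P = noUnguardedOutput⇒≉AWBB {P = T-HT (out x z P)} tt ↓out

≈WBB⇒≈AWBB : ∀ {P Q} → P ≈WBB Q → P ≈AWBB Q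
≈WBB⇒≈AWBB (S , (S-sym , S-barbs , S-red) , PSQ) = S , (S-sym , S-barbs , S-red) , PSQ

mainTheorem10 :
    -- the concrete counterexample P = x̄z.0
    (∀ (x z : Name) → ¬ (T-HT (out x z 𝟘) ≈AWBB out x z 𝟘))
    -- not valid up to ≈AWBB
    × ¬ (∀ (P : Proc) → T-HT P ≈AWBB P)
    -- hence not valid up to ≈WBB
    × ¬ (∀ (P : Proc) → T-HT P ≈WBB P)
    -- hence not valid up to any equivalence contained in ≈AWBB
    -- (e.g. weak oτ-bisimilarity, weak asynchronous bisimilarity)
    × (∀ (R : Rel₀) → (∀ {P Q} → R P Q → P ≈AWBB Q)
         → ¬ (∀ (P : Proc) → R (T-HT P) P))
mainTheorem10 =
    (λ x z → T-HT-out≉AWBB x z 𝟘)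
  , not-valid-AWBB
  , (λ valid → not-valid-AWBB (λ P → ≈WBB⇒≈AWBB (valid P)))
  , (λ R R⊆≈AWBB valid → not-valid-AWBB (λ P → R⊆≈AWBB (valid P)))
  where
  not-valid-AWBB : ¬ (∀ (P : Proc) → T-HT P ≈AWBB P)
  not-valid-AWBB valid = T-HT-out≉AWBB 0 0 𝟘 (valid (out 0 0 𝟘))
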